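{- For integers $n\ge2$ and $1-n\le m\le n$, define the sequence $(d_{m,n,k})_{k\ge1}$ by $d_{m,n,1}=n$, $d_{m,n,2}=n^2+2m$, and $d_{m,n,k}=n\,d_{m,n,k-1}+m\,d_{m,n,k-2}$ for $k\ge3$. For all integers $n\ge2$ and $1-n\le m\le n$, setting $\phi_{d_{m,n}}(k)=d_{m,n,k}$, we have $\Phi_1(k,\phi_{d_{m,n}})\equiv0\pmod k$ for all integers $k\ge1$. Moreover, the generating function $G_{d_{m,n}}(z)=\sum_{k\ge1}d_{m,n,k}z^k$ equals $$G_{d_{m,n}}(z)=\frac{nz+2mz^2}{1-nz-mz^2}.$$
   Context: For an integer-valued function $\phi$ on the positive integers: $\Phi_1(1,\phi)=\phi(1)$, and if $N=p_1^{k_1}\cdots p_r^{k_r}$ with $p_1,\dots,p_r$ distinct primes and $r,k_i\ge1$, then $\Phi_1(N,\phi)=\sum_{T\subseteq\{1,\dots,r\}}(-1)^{|T|}\phi\big(N/\prod_{i\in T}p_i\big)$ (empty product $=1$). -}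

module Defs where

open import Data.Nat as ℕ using (ℕ; zero; suc)
open import Data.Nat.DivMod using (_/_)
open import Data.Nat.Divisibility using (_∣?_)
open import Data.Nat.Primality using (prime?)
open import Data.Integer as ℤ using (ℤ; +_; -_; _+_; _-_; _*_)
open import Data.List using (List; []; _∷_; filter; upTo; map; length; _++_)
open import Data.Nat.ListAction using (product)
open import Relation.Nullary.Decidable using (_×-dec_)

primeDivisors : ℕ → List ℕ
primeDivisors N = filter (λ p → prime? p ×-dec p ∣? N) (upTo (suc N))

subsets : {A : Set} → List A → List (List A)
subsets []       = [] ∷ []
subsets (x ∷ xs) = subsets xs ++ map (x ∷_) (subsets xs)

-- Natural-number division, total (division by 0 gives 0; never used on 0 here).
div : ℕ → ℕ → ℕ
div n zero    = zero
div n (suc k) = n / suc k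

sign : ℕ → ℤ
sign zero    = + 1
sign (suc k) = - sign k

sumℤ : List ℤ → ℤ
sumℤ []       = + 0
sumℤ (x ∷ xs) = x + sumℤ xs

Φ₁ : ℕ → (ℕ → ℤ) → ℤ
Φ₁ N φ = sumℤ (map (λ T → sign (length T) * φ (div N (product T))) (subsets (primeDivisors N)))

-- d_{m,n,k}; indices k ≥ 1 are the paper's; index 0 is set to 0 (the
-- generating function has no constant term).
d : ℤ → ℤ → ℕ → ℤ
d m n 0 = + 0
d m n 1 = n
d m n 2 = n * n + (+ 2) * m
d m n (suc (suc (suc k))) = n * d m n (suc (suc k)) + m * d m n (suc k)

-- Formal power series over ℤ, as coefficient sequences.
Series : Set
Series = ℕ → ℤ

sumTo : ℕ → (ℕ → ℤ) → ℤ
sumTo zero    f = f zero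
sumTo (suc k) f = sumTo k f + f (suc k)

_⋆_ : Series → Series → Series
(f ⋆ g) k = sumTo k (λ i → f i * g (k ℕ.∸ i))

G : ℤ → ℤ → Series
G m n = d m n

denom : ℤ → ℤ → Series
denom m n 0 = + 1
denom m n 1 = - n
denom m n 2 = - m
denom m n (suc (suc (suc _))) = + 0

numer : ℤ → ℤ → Series
numer m n 0 = + 0
numer m n 1 = n
numer m n 2 = (+ 2) * m
numer m n (suc (suc (suc _))) = + 0

module Submission where

-- Write V(s,q) for the Lucas sequence V₀ = 2, V₁ = s, V_{k+2} = s V_{k+1} − q V_k;
-- from index 1 on, d_{m,n} = V(n, −m).  The divisibility k ∣ Φ₁(k, d) is
-- reduced to prime powers (prime-powers⇒∣), and p^{e+1} ∣ Φ₁(N, φ) follows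
-- from the local congruence φ(N) ≡ φ(N/p) (mod p^{e+1}) for p^{e+1} ∣ N by
-- pairing the subsets of prime divisors of N with and without p
-- (Φ₁-Divisibility).  The local congruence for V (PrimeModulus.stable) is
-- proved in the quadratic rings ℤ[ω], ω² = sω − q, where V_k = ω^k + ω̄^k.
-- There V_{kj}(s,q) = V_j(V_k, q^k), and the binomial theorem writes V_p as
-- s^p minus an inner sum whose coefficients are multiples of p; so
-- V_p(s,q) ≡ s (mod p) by Fermat, and (s,q) ≡ (s′,q′) (mod M) with p ∣ M gives
-- V_p(s,q) ≡ V_p(s′,q′) (mod pM).  Induction on e then yields V_{Kp} ≡ V_K
-- (mod p^{e+1}) whenever p^e ∣ K.  The generating function is a coefficient
-- check using the recurrence.

open import Defs
open import Level using (0ℓ)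
open import Data.Nat as ℕ using (ℕ; zero; suc; _∸_)
import Data.Nat.Properties as ℕP
open import Data.Nat.Combinatorics using (_C_; nCn≡1; nC1≡n; nCk+nC[k+1]≡[n+1]C[k+1])
open import Data.Nat.Primality.Factorisation using (factorise)
open import Data.Nat.Induction using (<-wellFounded)
open import Induction.WellFounded using (Acc; acc)
open import Data.Nat.Primality using (Prime; prime?; euclidsLemma; prime⇒irreducible; prime⇒nonZero; ¬prime[1])
open import Data.Sum using (inj₁; inj₂)
open import Relation.Nullary using (¬_; yes; no; contradiction)
open import Data.Nat.Divisibility as ℕ∣ using ()
open import Data.Nat.DivMod using (m/n*n≡m; 0/n≡0; m/n/o≡m/[n*o]; n/1≡n)
open import Data.Fin as Fin using (Fin; toℕ; inject₁; fromℕ)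
open import Data.Fin.Properties using (toℕ-inject₁; toℕ-fromℕ; toℕ<n)
import Data.Vec.Functional as Vec
open import Data.Integer as ℤ using (ℤ; +_; -_; _+_; _-_; _*_; _^_)
import Data.Integer.Properties as ℤP
open import Data.Integer.DivMod using (a≡a%n+[a/n]*n)
open import Data.Integer.Divisibility using (_∣_)
open import Data.Integer.Divisibility.Signed as ℤ∣
  using (divides; ∣m∣n⇒∣m+n; ∣m⇒∣-m; ∣n⇒∣m*n; ∣m⇒∣m*n)
open import Data.Integer.Tactic.RingSolver using (solve-∀)
open import Data.Product using (Σ; _×_; _,_; proj₁; proj₂)
open import Relation.Nullary.Decidable using (_×-dec_)
open import Function using (_∘_)
open import Data.List using (List; []; _∷_; _++_; map; length; upTo)
open import Data.List.Properties using (map-++; map-∘)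
open import Data.Nat.ListAction using (product)
open import Data.List.Membership.Propositional using (_∈_)
open import Data.List.Membership.Propositional.Properties using (∈-filter⁺; ∈-upTo⁺)
open import Data.List.Relation.Unary.Any using (here; there)
open import Data.List.Relation.Unary.All as All using (All; []; _∷_)
open import Data.List.Relation.Unary.All.Properties using (all-filter)
open import Data.List.Relation.Unary.AllPairs as AllPairs using ([]; _∷_)
open import Data.List.Relation.Unary.Unique.Propositional as Unique using (Unique)
import Data.List.Relation.Unary.Unique.Propositional.Properties as Unique
open import Relation.Binary.PropositionalEquality
  using (_≡_; _≢_; refl; sym; trans; cong; cong₂; subst; subst₂; isEquivalence; module ≡-Reasoning)
open import Algebra.Bundles using (CommutativeSemiring)
open import Relation.Binary.Bundles using (Setoid)
import Relation.Binary.Reasoning.Setoid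
open import Algebra.Structures {A = ℤ × ℤ} _≡_ using (IsMagma; IsCommutativeSemiring)
open import Algebra.Structures.Biased {A = ℤ × ℤ} _≡_ using (isCommutativeSemiringˡ; isCommutativeMonoidˡ)

infix 4 _≡_[mod_]

-- a ≡ b (mod M) means M ∣ a − b.  It is a record so that a and b stay
-- inferable from the type.
record _≡_[mod_] (a b M : ℤ) : Set where
  constructor mod
  field difference : M ℤ∣.∣ a - b
open _≡_[mod_]

module _ {M : ℤ} where

  mod-≡ : ∀ {a b} → a ≡ b → a ≡ b [mod M ]
  mod-≡ {a} refl = mod (divides (+ 0) (trans (ℤP.+-inverseʳ a) (sym (ℤP.*-zeroˡ M))))

  mod-refl : ∀ a → a ≡ a [mod M ]
  mod-refl a = mod-≡ refl

  mod-trans : ∀ {a b c} → a ≡ b [mod M ] → b ≡ c [mod M ] → a ≡ c [mod M ]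
  mod-trans {a} {b} {c} (mod h) (mod h′) = mod (subst (M ℤ∣.∣_) (split a b c) (∣m∣n⇒∣m+n h h′))
    where
    split : ∀ a b c → (a - b) + (b - c) ≡ a - c
    split = solve-∀

  mod-sym : ∀ {a b} → a ≡ b [mod M ] → b ≡ a [mod M ]
  mod-sym {a} {b} (mod h) = mod (subst (M ℤ∣.∣_) (flip a b) (∣m⇒∣-m h))
    where
    flip : ∀ a b → - (a - b) ≡ b - a
    flip = solve-∀

  mod-+ : ∀ {a b c e} → a ≡ b [mod M ] → c ≡ e [mod M ] → a + c ≡ b + e [mod M ]
  mod-+ {a} {b} {c} {e} (mod h) (mod h′) = mod (subst (M ℤ∣.∣_) (regroup a b c e) (∣m∣n⇒∣m+n h h′))
    where
    regroup : ∀ a b c e → (a - b) + (c - e) ≡ (a + c) - (b + e)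
    regroup = solve-∀

  mod-neg : ∀ {a b} → a ≡ b [mod M ] → - a ≡ - b [mod M ]
  mod-neg {a} {b} (mod h) = mod (subst (M ℤ∣.∣_) (negate a b) (∣m⇒∣-m h))
    where
    negate : ∀ a b → - (a - b) ≡ - a - - b
    negate = solve-∀

  mod-- : ∀ {a b c e} → a ≡ b [mod M ] → c ≡ e [mod M ] → a - c ≡ b - e [mod M ]
  mod-- h h′ = mod-+ h (mod-neg h′)

  mod-* : ∀ {a b c e} → a ≡ b [mod M ] → c ≡ e [mod M ] → a * c ≡ b * e [mod M ]
  mod-* {a} {b} {c} {e} (mod h) (mod h′) =
    mod (subst (M ℤ∣.∣_) (expand a b c e) (∣m∣n⇒∣m+n (∣n⇒∣m*n a h′) (∣m⇒∣m*n e h)))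
    where
    expand : ∀ a b c e → a * (c - e) + (a - b) * e ≡ a * c - b * e
    expand = solve-∀

  mod-^ : ∀ {a b} k → a ≡ b [mod M ] → a ^ k ≡ b ^ k [mod M ]
  mod-^ zero    h = mod-refl _
  mod-^ (suc k) h = mod-* h (mod-^ k h)

mod-∣ : ∀ {M M′ a b} → M ℤ∣.∣ M′ → a ≡ b [mod M′ ] → a ≡ b [mod M ]
mod-∣ M∣M′ (mod h) = mod (ℤ∣.∣-trans M∣M′ h)

mod-scale : ∀ {M a b} c → a ≡ b [mod M ] → c * a ≡ c * b [mod c * M ]
mod-scale {M} {a} {b} c (mod h) = mod (subst (c * M ℤ∣.∣_) (factor c a b) (ℤ∣.*-monoʳ-∣ c h))
  where
  factor : ∀ c a b → c * (a - b) ≡ c * a - c * b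
  factor = solve-∀

mod-factorˡ : ∀ {M N a b} → a ≡ b [mod M * N ] → a ≡ b [mod M ]
mod-factorˡ {N = N} = mod-∣ (∣m⇒∣m*n N ℤ∣.∣-refl)

∣-*-∣ : ∀ {i j m n} → i ℤ∣.∣ m → j ℤ∣.∣ n → i * j ℤ∣.∣ m * n
∣-*-∣ {i} {j} (divides u refl) (divides v refl) = divides (u * v) (rearrange u i v j)
  where
  rearrange : ∀ u i v j → u * i * (v * j) ≡ u * v * (i * j)
  rearrange = solve-∀

mod-setoid : ℤ → Setoid 0ℓ 0ℓ
mod-setoid M = record
  { Carrier       = ℤ
  ; _≈_           = λ a b → a ≡ b [mod M ]
  ; isEquivalence = record { refl = mod-refl _ ; sym = mod-sym ; trans = mod-trans } }

module ≡-mod-Reasoning (M : ℤ) = Relation.Binary.Reasoning.Setoid (mod-setoid M)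

mod-1 : ∀ a b → a ≡ b [mod + 1 ]
mod-1 a b = mod (divides (a - b) (sym (ℤP.*-identityʳ (a - b))))

lucas : ℤ → ℤ → ℕ → ℤ
lucas s q 0             = + 2
lucas s q 1             = s
lucas s q (suc (suc k)) = s * lucas s q (suc k) - q * lucas s q k

d≡lucas : ∀ m n k → d m n (suc k) ≡ lucas n (- m) (suc k)
d≡lucas m n zero          = refl
d≡lucas m n (suc zero)    = second m n
  where
  second : ∀ m n → n * n + + 2 * m ≡ n * n - (- m) * + 2
  second = solve-∀
d≡lucas m n (suc (suc k)) rewrite d≡lucas m n (suc k) | d≡lucas m n k =
  step m n (lucas n (- m) (suc (suc k))) (lucas n (- m) (suc k))
  where
  step : ∀ m n a b → n * a + m * b ≡ n * a - (- m) * b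
  step = solve-∀

-- For n + 1 = p
-- prime every coefficient of the inner sum is divisible by p.
module BinomialSplit {c ℓ} (S : CommutativeSemiring c ℓ) where
  open CommutativeSemiring S renaming (trans to ≈-trans; _+_ to _⊕_; _*_ to _⊗_)
  open import Algebra.Properties.Semiring.Exp semiring using () renaming (_^_ to _↑_)
  open import Algebra.Properties.Semiring.Mult semiring using (×-congʳ; ×-comm-*) renaming (_×_ to _·_)
  open import Algebra.Properties.Semiring.Sum semiring using (sum; sum-cong-≋; sum-cong-≗; sum-init-last; sum-replicate-zero)
  open import Algebra.Properties.CommutativeSemiring.Binomial S using (theorem; binomialExpansion)
  open import Relation.Binary.Reasoning.Setoid setoid

  innerTerm : ℕ → Carrier → Carrier → ℕ → Carrier
  innerTerm n x y k = (suc n C suc k) · (x ↑ suc k ⊗ y ↑ (n ∸ k))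

  inner : ℕ → Carrier → Carrier → Carrier
  inner n x y = sum {n} (λ i → innerTerm n x y (toℕ i))

  binomial-split : ∀ n x y → (x ⊕ y) ↑ suc n ≈ y ↑ suc n ⊕ (inner n x y ⊕ x ↑ suc n)
  binomial-split n x y = begin
    (x ⊕ y) ↑ suc n                                   ≈⟨ theorem (suc n) x y ⟩
    binomialExpansion x y (suc n)                     ≡⟨⟩
    term 0 ⊕ sum {suc n} (λ i → term (suc (toℕ i)))   ≈⟨ +-cong first (sum-init-last {n} (λ i → term (suc (toℕ i)))) ⟩
    y ↑ suc n ⊕ (sum {n} (λ i → term (suc (toℕ (inject₁ i))))
                 ⊕ term (suc (toℕ (fromℕ n))))        ≡⟨ cong₂ (λ u v → y ↑ suc n ⊕ (u ⊕ v)) inits lastIndex ⟩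
    y ↑ suc n ⊕ (inner n x y ⊕ term (suc n))          ≈⟨ +-congˡ (+-congˡ last) ⟩
    y ↑ suc n ⊕ (inner n x y ⊕ x ↑ suc n)             ∎
    where
    term : ℕ → Carrier
    term k = (suc n C k) · (x ↑ k ⊗ y ↑ (suc n ∸ k))
    first : term 0 ≈ y ↑ suc n
    first = ≈-trans (+-identityʳ _) (*-identityˡ _)
    inits : sum {n} (λ i → term (suc (toℕ (inject₁ i)))) ≡ inner n x y
    inits = sum-cong-≗ {n} (λ i → cong (λ k → term (suc k)) (toℕ-inject₁ i))
    lastIndex : term (suc (toℕ (fromℕ n))) ≡ term (suc n)
    lastIndex = cong (λ k → term (suc k)) (toℕ-fromℕ n)
    last : term (suc n) ≈ x ↑ suc n
    last = begin
      term (suc n)                 ≡⟨ cong₂ (λ c k → c · (x ↑ suc n ⊗ y ↑ k)) (nCn≡1 (suc n)) (ℕP.n∸n≡0 n) ⟩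
      x ↑ suc n ⊗ 1# ⊕ 0#          ≈⟨ +-identityʳ _ ⟩
      x ↑ suc n ⊗ 1#               ≈⟨ *-identityʳ _ ⟩
      x ↑ suc n                    ∎

  -- Every inner term contains a positive power of x.
  inner-zeroˡ : ∀ n y → inner n 0# y ≈ 0#
  inner-zeroˡ n y = ≈-trans (sum-cong-≋ {n} vanishing) (sum-replicate-zero n)
    where
    vanishing : ∀ i → innerTerm n 0# y (toℕ i) ≈ 0#
    vanishing i = let k = toℕ i ; c = suc n C suc k ; w = 0# ↑ k ; z = y ↑ (n ∸ k) in begin
      c · ((0# ⊗ w) ⊗ z)   ≈⟨ ×-congʳ c (*-assoc 0# w z) ⟩
      c · (0# ⊗ (w ⊗ z))   ≈⟨ ×-comm-* c 0# (w ⊗ z) ⟨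
      0# ⊗ (c · (w ⊗ z))   ≈⟨ zeroˡ _ ⟩
      0#                   ∎

-- The quadratic rings ℤ[ω] with ω² = s·ω − q, in which V_k(s,q) = ω^k + ω̄^k
-- for the two roots ω, ω̄ = s − ω of X² − s X + q.  An element a + b·ω is
-- stored as the pair (a , b); addition, zero, one and the scalars ι a do not
-- depend on s and q.
infixl 6 _⊕_
_⊕_ : ℤ × ℤ → ℤ × ℤ → ℤ × ℤ
(a , b) ⊕ (c , e) = (a + c , b + e)

ι : ℤ → ℤ × ℤ
ι a = (a , + 0)

cancel-ι : ∀ {z a b} → ι a ≡ z ⊕ ι b → z ≡ ι (a - b)
cancel-ι {z₁ , z₂} {a} {b} eq = cong₂ _,_
  (trans (add-sub z₁ b) (cong (_- b) (sym (cong proj₁ eq))))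
  (trans (sym (ℤP.+-identityʳ z₂)) (sym (cong proj₂ eq)))
  where
  add-sub : ∀ z b → z ≡ (z + b) - b
  add-sub = solve-∀

module Quadratic (s q : ℤ) where

  infixl 7 _⊗_
  _⊗_ : ℤ × ℤ → ℤ × ℤ → ℤ × ℤ
  (a , b) ⊗ (c , e) = (a * c - q * (b * e) , a * e + b * c + s * (b * e))

  ω ω̄ : ℤ × ℤ
  ω = (+ 0 , + 1)
  ω̄ = (s , - + 1)

  private
    ⊕-assoc : ∀ x y z → (x ⊕ y) ⊕ z ≡ x ⊕ (y ⊕ z)
    ⊕-assoc (a , b) (c , e) (f , g) = cong₂ _,_ (ℤP.+-assoc a c f) (ℤP.+-assoc b e g)

    ⊕-comm : ∀ x y → x ⊕ y ≡ y ⊕ x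
    ⊕-comm (a , b) (c , e) = cong₂ _,_ (ℤP.+-comm a c) (ℤP.+-comm b e)

    ⊕-identityˡ : ∀ x → ι (+ 0) ⊕ x ≡ x
    ⊕-identityˡ (a , b) = cong₂ _,_ (ℤP.+-identityˡ a) (ℤP.+-identityˡ b)

    ⊗-assoc : ∀ x y z → (x ⊗ y) ⊗ z ≡ x ⊗ (y ⊗ z)
    ⊗-assoc (a , b) (c , e) (f , g) = cong₂ _,_ (first a b c e f g s q) (second a b c e f g s q)
      where
      first : ∀ a b c e f g s q →
        (a * c - q * (b * e)) * f - q * ((a * e + b * c + s * (b * e)) * g)
        ≡ a * (c * f - q * (e * g)) - q * (b * (c * g + e * f + s * (e * g)))
      first = solve-∀
      second : ∀ a b c e f g s q →
        (a * c - q * (b * e)) * g + (a * e + b * c + s * (b * e)) * f + s * ((a * e + b * c + s * (b * e)) * g)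
        ≡ a * (c * g + e * f + s * (e * g)) + b * (c * f - q * (e * g)) + s * (b * (c * g + e * f + s * (e * g)))
      second = solve-∀

    ⊗-comm : ∀ x y → x ⊗ y ≡ y ⊗ x
    ⊗-comm (a , b) (c , e) = cong₂ _,_ (first a b c e q) (second a b c e s)
      where
      first : ∀ a b c e q → a * c - q * (b * e) ≡ c * a - q * (e * b)
      first = solve-∀
      second : ∀ a b c e s → a * e + b * c + s * (b * e) ≡ c * b + e * a + s * (e * b)
      second = solve-∀

    ⊗-identityˡ : ∀ x → ι (+ 1) ⊗ x ≡ x
    ⊗-identityˡ (a , b) = cong₂ _,_ (first a b q) (second a b s)
      where
      first : ∀ a b q → + 1 * a - q * (+ 0 * b) ≡ a
      first = solve-∀
      second : ∀ a b s → + 1 * b + + 0 * a + s * (+ 0 * b) ≡ b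
      second = solve-∀

    ⊗-distribʳ : ∀ x y z → (y ⊕ z) ⊗ x ≡ y ⊗ x ⊕ z ⊗ x
    ⊗-distribʳ (a , b) (c , e) (f , g) = cong₂ _,_ (first a b c e f g q) (second a b c e f g s)
      where
      first : ∀ a b c e f g q → (c + f) * a - q * ((e + g) * b) ≡ (c * a - q * (e * b)) + (f * a - q * (g * b))
      first = solve-∀
      second : ∀ a b c e f g s → (c + f) * b + (e + g) * a + s * ((e + g) * b)
                                 ≡ (c * b + e * a + s * (e * b)) + (f * b + g * a + s * (g * b))
      second = solve-∀

    ⊗-zeroˡ : ∀ x → ι (+ 0) ⊗ x ≡ ι (+ 0)
    ⊗-zeroˡ (a , b) = cong₂ _,_ (first a b q) (second a b s)
      where
      first : ∀ a b q → + 0 * a - q * (+ 0 * b) ≡ + 0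
      first = solve-∀
      second : ∀ a b s → + 0 * b + + 0 * a + s * (+ 0 * b) ≡ + 0
      second = solve-∀

    isCommutativeSemiring : IsCommutativeSemiring _⊕_ _⊗_ (ι (+ 0)) (ι (+ 1))
    isCommutativeSemiring = isCommutativeSemiringˡ (record
      { +-isCommutativeMonoid = isCommutativeMonoidˡ (record
          { isSemigroup = record { isMagma = magma _⊕_ ; assoc = ⊕-assoc }
          ; identityˡ   = ⊕-identityˡ
          ; comm        = ⊕-comm })
      ; *-isCommutativeMonoid = isCommutativeMonoidˡ (record
          { isSemigroup = record { isMagma = magma _⊗_ ; assoc = ⊗-assoc }
          ; identityˡ   = ⊗-identityˡ
          ; comm        = ⊗-comm })
      ; distribʳ = ⊗-distribʳ
      ; zeroˡ    = ⊗-zeroˡ })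
      where
      magma : ∀ _∙_ → IsMagma _∙_
      magma _∙_ = record { isEquivalence = isEquivalence ; ∙-cong = cong₂ _∙_ }

  commutativeSemiring : CommutativeSemiring 0ℓ 0ℓ
  commutativeSemiring = record { isCommutativeSemiring = isCommutativeSemiring }

  open CommutativeSemiring commutativeSemiring using (semiring; *-identityʳ)
  open import Algebra.Properties.Semiring.Exp semiring public using () renaming (_^_ to _↑_)
  open import Algebra.Properties.Semiring.Mult semiring public using () renaming (_×_ to _·_)
  open import Algebra.Properties.Semiring.Exp semiring using (^-assocʳ)
  open import Algebra.Properties.CommutativeSemiring.Exp commutativeSemiring using (^-distrib-*)
  open import Algebra.Solver.Ring.NaturalCoefficients.Default commutativeSemiring using (solve; _:+_; _:*_; _:=_)
  open BinomialSplit commutativeSemiring public using (inner; binomial-split; inner-zeroˡ)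

  ι-⊗ : ∀ a b → ι a ⊗ ι b ≡ ι (a * b)
  ι-⊗ a b = cong₂ _,_ (first a b q) (second a b s)
    where
    first : ∀ a b q → a * b - q * (+ 0 * + 0) ≡ a * b
    first = solve-∀
    second : ∀ a b s → a * + 0 + + 0 * b + s * (+ 0 * + 0) ≡ + 0
    second = solve-∀

  ι-↑ : ∀ a k → ι a ↑ k ≡ ι (a ^ k)
  ι-↑ a zero    = refl
  ι-↑ a (suc k) = trans (cong (ι a ⊗_) (ι-↑ a k)) (ι-⊗ a (a ^ k))

  ω⊕ω̄ : ω ⊕ ω̄ ≡ ι s
  ω⊕ω̄ = cong (_, + 0) (ℤP.+-identityˡ s)

  ω⊗ω̄ : ω ⊗ ω̄ ≡ ι q
  ω⊗ω̄ = cong₂ _,_ (first s q) (second s)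
    where
    first : ∀ s q → + 0 * s - q * (+ 1 * - + 1) ≡ q
    first = solve-∀
    second : ∀ s → + 0 * - + 1 + + 1 * s + s * (+ 1 * - + 1) ≡ + 0
    second = solve-∀

  power-sums : ∀ {u ū S Q} → u ⊕ ū ≡ ι S → u ⊗ ū ≡ ι Q →
               ∀ j → u ↑ j ⊕ ū ↑ j ≡ ι (lucas S Q j)
  power-sums {u} {ū} {S} {Q} sum≡ prod≡ = go
    where
    newton : ∀ X Y → (u ⊕ ū) ⊗ (u ⊗ X ⊕ ū ⊗ Y) ≡ (u ⊗ (u ⊗ X) ⊕ ū ⊗ (ū ⊗ Y)) ⊕ (u ⊗ ū) ⊗ (X ⊕ Y)
    newton X Y = solve 4 (λ u ū X Y → (u :+ ū) :* (u :* X :+ ū :* Y)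
                                       := (u :* (u :* X) :+ ū :* (ū :* Y)) :+ (u :* ū) :* (X :+ Y)) refl u ū X Y
    go : ∀ j → u ↑ j ⊕ ū ↑ j ≡ ι (lucas S Q j)
    go 0             = refl
    go 1             = trans (cong₂ _⊕_ (*-identityʳ u) (*-identityʳ ū)) sum≡
    go (suc (suc j)) = cancel-ι (begin
      ι (S * lucas S Q (suc j))                          ≡⟨ ι-⊗ S (lucas S Q (suc j)) ⟨
      ι S ⊗ ι (lucas S Q (suc j))                        ≡⟨ cong₂ _⊗_ sum≡ (go (suc j)) ⟨
      (u ⊕ ū) ⊗ (u ↑ suc j ⊕ ū ↑ suc j)                   ≡⟨ newton (u ↑ j) (ū ↑ j) ⟩
      (u ↑ suc (suc j) ⊕ ū ↑ suc (suc j)) ⊕ (u ⊗ ū) ⊗ (u ↑ j ⊕ ū ↑ j)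
                                                         ≡⟨ cong (next ⊕_) (cong₂ _⊗_ prod≡ (go j)) ⟩
      (u ↑ suc (suc j) ⊕ ū ↑ suc (suc j)) ⊕ ι Q ⊗ ι (lucas S Q j)
                                                         ≡⟨ cong (next ⊕_) (ι-⊗ Q (lucas S Q j)) ⟩
      (u ↑ suc (suc j) ⊕ ū ↑ suc (suc j)) ⊕ ι (Q * lucas S Q j) ∎)
      where
      open ≡-Reasoning
      next : ℤ × ℤ
      next = u ↑ suc (suc j) ⊕ ū ↑ suc (suc j)

  lucas-ω : ∀ k → ω ↑ k ⊕ ω̄ ↑ k ≡ ι (lucas s q k)
  lucas-ω = power-sums ω⊕ω̄ ω⊗ω̄

  ·-coords : ∀ c x → c · x ≡ (+ c * proj₁ x , + c * proj₂ x)
  ·-coords zero    x = sym (cong₂ _,_ (ℤP.*-zeroˡ (proj₁ x)) (ℤP.*-zeroˡ (proj₂ x)))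
  ·-coords (suc c) x = trans (cong (x ⊕_) (·-coords c x)) (cong₂ _,_ (add-one (proj₁ x)) (add-one (proj₂ x)))
    where
    add-one : ∀ a → a + + c * a ≡ + suc c * a
    add-one a = trans (cong (_+ + c * a) (sym (ℤP.*-identityˡ a))) (sym (ℤP.*-distribʳ-+ a (+ 1) (+ c)))

  ω↑⊗ω̄↑ : ∀ k → ω ↑ k ⊗ ω̄ ↑ k ≡ ι (q ^ k)
  ω↑⊗ω̄↑ k = trans (sym (^-distrib-* ω ω̄ k)) (trans (cong (_↑ k) ω⊗ω̄) (ι-↑ q k))

  lucas-* : ∀ k j → lucas s q (k ℕ.* j) ≡ lucas (lucas s q k) (q ^ k) j
  lucas-* k j = cong proj₁ (begin
    ι (lucas s q (k ℕ.* j))           ≡⟨ lucas-ω (k ℕ.* j) ⟨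
    ω ↑ (k ℕ.* j) ⊕ ω̄ ↑ (k ℕ.* j)     ≡⟨ cong₂ _⊕_ (^-assocʳ ω k j) (^-assocʳ ω̄ k j) ⟨
    (ω ↑ k) ↑ j ⊕ (ω̄ ↑ k) ↑ j         ≡⟨ power-sums (lucas-ω k) (ω↑⊗ω̄↑ k) j ⟩
    ι (lucas (lucas s q k) (q ^ k) j) ∎)
    where open ≡-Reasoning

  -- Expanding s^{n+1} = (ω + ω̄)^{n+1} binomially: the outer terms give
  -- V_{n+1}, the rest is the first coordinate of the inner sum.
  lucas-binomial : ∀ n → s ^ suc n ≡ lucas s q (suc n) + proj₁ (inner n ω ω̄)
  lucas-binomial n = begin
    s ^ suc n                                  ≡⟨ cong proj₁ (ι-↑ s (suc n)) ⟨
    proj₁ (ι s ↑ suc n)                        ≡⟨ cong (λ x → proj₁ (x ↑ suc n)) ω⊕ω̄ ⟨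
    proj₁ ((ω ⊕ ω̄) ↑ suc n)                    ≡⟨ cong proj₁ (binomial-split n ω ω̄) ⟩
    proj₁ (ω̄ ↑ suc n) + (I + proj₁ (ω ↑ suc n)) ≡⟨ regroup (proj₁ (ω ↑ suc n)) (proj₁ (ω̄ ↑ suc n)) I ⟩
    (proj₁ (ω ↑ suc n) + proj₁ (ω̄ ↑ suc n)) + I ≡⟨ cong (λ x → proj₁ x + I) (lucas-ω (suc n)) ⟩
    lucas s q (suc n) + I                      ∎
    where
    open ≡-Reasoning
    I : ℤ
    I = proj₁ (inner n ω ω̄)
    regroup : ∀ a b i → b + (i + a) ≡ (a + b) + i
    regroup = solve-∀

infix 4 _≈_[mod_]

_≈_[mod_] : ℤ × ℤ → ℤ × ℤ → ℤ → Set
x ≈ y [mod M ] = proj₁ x ≡ proj₁ y [mod M ] × proj₂ x ≡ proj₂ y [mod M ]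

≈-refl : ∀ {M} x → x ≈ x [mod M ]
≈-refl x = mod-refl (proj₁ x) , mod-refl (proj₂ x)

≈-1 : ∀ x y → x ≈ y [mod + 1 ]
≈-1 x y = mod-1 (proj₁ x) (proj₁ y) , mod-1 (proj₂ x) (proj₂ y)

⊕-cong : ∀ {M x x′ y y′} → x ≈ x′ [mod M ] → y ≈ y′ [mod M ] → x ⊕ y ≈ x′ ⊕ y′ [mod M ]
⊕-cong (a , b) (c , e) = mod-+ a c , mod-+ b e

∑-cong : ∀ {M n} {f g : Fin n → ℤ × ℤ} → (∀ i → f i ≈ g i [mod M ]) →
         Vec.foldr _⊕_ (ι (+ 0)) f ≈ Vec.foldr _⊕_ (ι (+ 0)) g [mod M ]
∑-cong {n = zero}  f≈g = ≈-refl (ι (+ 0))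
∑-cong {n = suc n} f≈g = ⊕-cong (f≈g Fin.zero) (∑-cong (λ i → f≈g (Fin.suc i)))

module Transfer {M s q s′ q′ : ℤ} (s≡s′ : s ≡ s′ [mod M ]) (q≡q′ : q ≡ q′ [mod M ]) where
  private
    module R  = Quadratic s q
    module R′ = Quadratic s′ q′

  ⊗-cong : ∀ {x x′ y y′} → x ≈ x′ [mod M ] → y ≈ y′ [mod M ] → x R.⊗ y ≈ x′ R′.⊗ y′ [mod M ]
  ⊗-cong (a , b) (c , e) = mod-- (mod-* a c) (mod-* q≡q′ (mod-* b e))
                         , mod-+ (mod-+ (mod-* a e) (mod-* b c)) (mod-* s≡s′ (mod-* b e))

  ↑-cong : ∀ {x x′} k → x ≈ x′ [mod M ] → x R.↑ k ≈ x′ R′.↑ k [mod M ]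
  ↑-cong zero    x≈x′ = ≈-refl (ι (+ 1))
  ↑-cong (suc k) x≈x′ = ⊗-cong x≈x′ (↑-cong k x≈x′)

  ·-cong : ∀ {P x x′} c → P ℕ∣.∣ c → x ≈ x′ [mod M ] → c R.· x ≈ c R′.· x′ [mod + P * M ]
  ·-cong {P} {x} {x′} c (ℕ∣.divides u refl) (a , b)
    rewrite R.·-coords (u ℕ.* P) x | R′.·-coords (u ℕ.* P) x′ = scaled a , scaled b
    where
    scaled : ∀ {y y′} → y ≡ y′ [mod M ] → + (u ℕ.* P) * y ≡ + (u ℕ.* P) * y′ [mod + P * M ]
    scaled {y} {y′} y≡y′ = subst₂ (λ z z′ → z ≡ z′ [mod + P * M ]) (reassoc y) (reassoc y′)
                                  (mod-* (mod-refl (+ u)) (mod-scale (+ P) y≡y′))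
      where
      reassoc : ∀ y → + u * (+ P * y) ≡ + (u ℕ.* P) * y
      reassoc y = trans (sym (ℤP.*-assoc (+ u) (+ P) y)) (cong (_* y) (sym (ℤP.pos-* u P)))

  inner-cong : ∀ n → (∀ k → k ℕ.< n → suc n ℕ∣.∣ suc n C suc k) →
               ∀ {x x′ y y′} → x ≈ x′ [mod M ] → y ≈ y′ [mod M ] →
               R.inner n x y ≈ R′.inner n x′ y′ [mod + suc n * M ]
  inner-cong n divisible x≈x′ y≈y′ = ∑-cong (λ i → let k = toℕ i in
    ·-cong (suc n C suc k) (divisible k (toℕ<n i)) (⊗-cong (↑-cong (suc k) x≈x′) (↑-cong (n ∸ k) y≈y′)))

absorption : ∀ n k → suc k ℕ.* (suc n C suc k) ≡ suc n ℕ.* (n C k)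
absorption zero    zero    = refl
absorption zero    (suc k) = ℕP.*-zeroʳ (2 ℕ.+ k)
absorption (suc n) zero    = trans (ℕP.*-identityˡ _) (trans (nC1≡n (2 ℕ.+ n)) (sym (ℕP.*-identityʳ (2 ℕ.+ n))))
absorption (suc n) (suc k) = begin
  suc (suc k) ℕ.* (suc (suc n) C suc (suc k))         ≡⟨ cong (suc (suc k) ℕ.*_) (nCk+nC[k+1]≡[n+1]C[k+1] (suc n) (suc k)) ⟨
  suc (suc k) ℕ.* (A ℕ.+ B)                           ≡⟨ ℕP.*-distribˡ-+ (suc (suc k)) A B ⟩
  A ℕ.+ suc k ℕ.* A ℕ.+ suc (suc k) ℕ.* B             ≡⟨ cong₂ (λ x y → A ℕ.+ x ℕ.+ y) (absorption n k) (absorption n (suc k)) ⟩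
  A ℕ.+ suc n ℕ.* (n C k) ℕ.+ suc n ℕ.* (n C suc k)   ≡⟨ ℕP.+-assoc A _ _ ⟩
  A ℕ.+ (suc n ℕ.* (n C k) ℕ.+ suc n ℕ.* (n C suc k)) ≡⟨ cong (A ℕ.+_) (ℕP.*-distribˡ-+ (suc n) (n C k) (n C suc k)) ⟨
  A ℕ.+ suc n ℕ.* (n C k ℕ.+ n C suc k)               ≡⟨ cong (λ x → A ℕ.+ suc n ℕ.* x) (nCk+nC[k+1]≡[n+1]C[k+1] n k) ⟩
  suc (suc n) ℕ.* A                                   ∎
  where
  open ≡-Reasoning
  A B : ℕ
  A = suc n C suc k
  B = suc n C suc (suc k)

prime∣binomial : ∀ {p} → Prime p → ∀ k → 0 ℕ.< k → k ℕ.< p → p ℕ∣.∣ p C k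
prime∣binomial {suc n} isPrime (suc k) _ k<p
  with euclidsLemma (suc k) (suc n C suc k) isPrime
         (ℕ∣.divides (n C k) (trans (absorption n k) (ℕP.*-comm (suc n) (n C k))))
... | inj₁ p∣k+1 = contradiction p∣k+1 (ℕ∣.>⇒∤ k<p)
... | inj₂ p∣C   = p∣C

module PrimeModulus {k : ℕ} (isPrime : Prime (2 ℕ.+ k)) where

  p : ℕ
  p = 2 ℕ.+ k

  P : ℤ
  P = + p

  inner-divisible : ∀ j → j ℕ.< suc k → p ℕ∣.∣ p C suc j
  inner-divisible j j<k = prime∣binomial isPrime (suc j) (ℕ.s≤s ℕ.z≤n) (ℕ.s≤s j<k)

  inner-cong : ∀ {M s q s′ q′} → s ≡ s′ [mod M ] → q ≡ q′ [mod M ] →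
               ∀ {x x′ y y′} → x ≈ x′ [mod M ] → y ≈ y′ [mod M ] →
               Quadratic.inner s q (suc k) x y ≈ Quadratic.inner s′ q′ (suc k) x′ y′ [mod P * M ]
  inner-cong s≡s′ q≡q′ = Transfer.inner-cong s≡s′ q≡q′ (suc k) inner-divisible

  -- The binomial theorem in ℤ, read off from the scalars of ℤ[ω]/(ω²).
  private
    module R₀ = Quadratic (+ 0) (+ 0)

  innerℤ : ℤ → ℤ → ℤ
  innerℤ a b = proj₁ (R₀.inner (suc k) (ι a) (ι b))

  binomialℤ : ∀ a b → (a + b) ^ p ≡ b ^ p + (innerℤ a b + a ^ p)
  binomialℤ a b = begin
    (a + b) ^ p                                            ≡⟨ cong proj₁ (R₀.ι-↑ (a + b) p) ⟨
    proj₁ ((ι a ⊕ ι b) R₀.↑ p)                             ≡⟨ cong proj₁ (R₀.binomial-split (suc k) (ι a) (ι b)) ⟩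
    proj₁ (ι b R₀.↑ p) + (innerℤ a b + proj₁ (ι a R₀.↑ p)) ≡⟨ cong₂ (λ u v → u + (innerℤ a b + v))
                                                                     (cong proj₁ (R₀.ι-↑ b p)) (cong proj₁ (R₀.ι-↑ a p)) ⟩
    b ^ p + (innerℤ a b + a ^ p)                           ∎
    where open ≡-Reasoning

  innerℤ-cong : ∀ {M a a′ b b′} → a ≡ a′ [mod M ] → b ≡ b′ [mod M ] → innerℤ a b ≡ innerℤ a′ b′ [mod P * M ]
  innerℤ-cong a≡a′ b≡b′ = proj₁ (inner-cong {s = + 0} {+ 0} {+ 0} {+ 0} (mod-refl (+ 0)) (mod-refl (+ 0))
                                             (a≡a′ , mod-refl (+ 0)) (b≡b′ , mod-refl (+ 0)))

  innerℤ-zeroˡ : ∀ b → innerℤ (+ 0) b ≡ + 0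
  innerℤ-zeroˡ b = cong proj₁ (R₀.inner-zeroˡ (suc k) (ι b))

  innerℤ≡0 : ∀ a b → innerℤ a b ≡ + 0 [mod P ]
  innerℤ≡0 a b = mod-factorˡ {N = + 1} (subst (λ z → innerℤ a b ≡ z [mod P * + 1 ]) (innerℤ-zeroˡ b)
                                    (innerℤ-cong (mod-1 a (+ 0)) (mod-1 b b)))

  frobenius : ∀ a b → (a + b) ^ p ≡ a ^ p + b ^ p [mod P ]
  frobenius a b = begin
    (a + b) ^ p                   ≡⟨ binomialℤ a b ⟩
    b ^ p + (innerℤ a b + a ^ p)  ≈⟨ mod-+ (mod-refl (b ^ p)) (mod-+ (innerℤ≡0 a b) (mod-refl (a ^ p))) ⟩
    b ^ p + (+ 0 + a ^ p)         ≡⟨ regroup (a ^ p) (b ^ p) ⟩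
    a ^ p + b ^ p                 ∎
    where
    open ≡-mod-Reasoning P
    regroup : ∀ x y → y + (+ 0 + x) ≡ x + y
    regroup = solve-∀

  fermat-ℕ : ∀ r → (+ r) ^ p ≡ + r [mod P ]
  fermat-ℕ zero    = mod-≡ (ℤP.*-zeroˡ ((+ 0) ^ suc k))
  fermat-ℕ (suc r) = mod-trans (frobenius (+ 1) (+ r)) (mod-+ (mod-≡ (ℤP.^-zeroˡ p)) (fermat-ℕ r))

  residue : ∀ a → a ≡ + (a ℤ.% P) [mod P ]
  residue a = mod (divides (a ℤ./ P) (trans (cong (_- r) (a≡a%n+[a/n]*n a P)) (cancel r (a ℤ./ P * P))))
    where
    r : ℤ
    r = + (a ℤ.% P)
    cancel : ∀ r x → r + x - r ≡ x
    cancel = solve-∀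

  fermat : ∀ a → a ^ p ≡ a [mod P ]
  fermat a = begin
    a ^ p             ≈⟨ mod-^ p (residue a) ⟩
    (+ (a ℤ.% P)) ^ p ≈⟨ fermat-ℕ (a ℤ.% P) ⟩
    + (a ℤ.% P)       ≈⟨ mod-sym (residue a) ⟩
    a                 ∎
    where open ≡-mod-Reasoning P

  power-lift : ∀ {M a b} → P ℤ∣.∣ M → a ≡ b [mod M ] → a ^ p ≡ b ^ p [mod P * M ]
  power-lift {M} {a} {b} P∣M (mod M∣δ) = begin
    a ^ p                          ≡⟨ cong (_^ p) (split a b) ⟩
    (δ + b) ^ p                    ≡⟨ binomialℤ δ b ⟩
    b ^ p + (innerℤ δ b + δ ^ p)   ≈⟨ mod-+ (mod-refl (b ^ p)) (mod-+ inner≡0 δ^p≡0) ⟩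
    b ^ p + (+ 0 + + 0)            ≡⟨ ℤP.+-identityʳ (b ^ p) ⟩
    b ^ p                          ∎
    where
    open ≡-mod-Reasoning (P * M)
    δ : ℤ
    δ = a - b
    split : ∀ a b → a ≡ (a - b) + b
    split = solve-∀
    δ≡0 : δ ≡ + 0 [mod M ]
    δ≡0 = mod (subst (M ℤ∣.∣_) (sym (ℤP.+-identityʳ δ)) M∣δ)
    inner≡0 : innerℤ δ b ≡ + 0 [mod P * M ]
    inner≡0 = subst (λ z → innerℤ δ b ≡ z [mod P * M ]) (innerℤ-zeroˡ b) (innerℤ-cong δ≡0 (mod-refl b))
    -- δ^p = δ·δ·δ^k with p ∣ δ and M ∣ δ.
    δ^p≡0 : δ ^ p ≡ + 0 [mod P * M ]
    δ^p≡0 = mod (subst (P * M ℤ∣.∣_) (trans (ℤP.*-assoc δ δ (δ ^ k)) (sym (ℤP.+-identityʳ (δ ^ p))))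
                       (∣m⇒∣m*n (δ ^ k) (∣-*-∣ (ℤ∣.∣-trans P∣M M∣δ) M∣δ)))

  I : ℤ → ℤ → ℤ
  I s q = proj₁ (Quadratic.inner s q (suc k) (Quadratic.ω s q) (Quadratic.ω̄ s q))

  lucas-p≡ : ∀ s q → lucas s q p ≡ s ^ p - I s q
  lucas-p≡ s q = trans (sym (cancel (lucas s q p) (I s q))) (cong (_- I s q) (sym (Quadratic.lucas-binomial s q (suc k))))
    where
    cancel : ∀ v i → v + i - i ≡ v
    cancel = solve-∀

  lucas-prime : ∀ s q → lucas s q p ≡ s [mod P ]
  lucas-prime s q = begin
    lucas s q p    ≡⟨ lucas-p≡ s q ⟩
    s ^ p - I s q  ≈⟨ mod-- (fermat s) I≡0 ⟩
    s - + 0        ≡⟨ ℤP.+-identityʳ s ⟩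
    s              ∎
    where
    open ≡-mod-Reasoning P
    module R = Quadratic s q
    -- modulo 1 the root ω may be replaced by 0, which kills the inner sum
    I≡0 : I s q ≡ + 0 [mod P ]
    I≡0 = mod-factorˡ {N = + 1} (subst (λ z → I s q ≡ z [mod P * + 1 ]) (cong proj₁ (R.inner-zeroˡ (suc k) R.ω̄))
            (proj₁ (inner-cong (mod-1 s s) (mod-1 q q) (≈-1 R.ω (ι (+ 0))) (≈-1 R.ω̄ R.ω̄))))

  lucas-lift : ∀ {M s q s′ q′} → P ℤ∣.∣ M → s ≡ s′ [mod M ] → q ≡ q′ [mod M ] →
               lucas s q p ≡ lucas s′ q′ p [mod P * M ]
  lucas-lift {M} {s} {q} {s′} {q′} P∣M s≡s′ q≡q′ = begin
    lucas s q p        ≡⟨ lucas-p≡ s q ⟩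
    s ^ p - I s q      ≈⟨ mod-- (power-lift P∣M s≡s′) (proj₁ (inner-cong s≡s′ q≡q′ (≈-refl (+ 0 , + 1)) (s≡s′ , mod-refl (- + 1)))) ⟩
    s′ ^ p - I s′ q′   ≡⟨ lucas-p≡ s′ q′ ⟨
    lucas s′ q′ p      ∎
    where open ≡-mod-Reasoning (P * M)

  Stable : ℤ → ℤ → ℤ → ℕ → Set
  Stable s q M K = lucas s q (K ℕ.* p) ≡ lucas s q K [mod M ] × q ^ (K ℕ.* p) ≡ q ^ K [mod M ]

  -- One p-adic step: stability of K modulo M (p ∣ M) gives stability of
  -- K·p modulo p·M, by the composition law and lifting.
  stable-step : ∀ {M} s q K → P ℤ∣.∣ M → Stable s q M K → Stable s q (P * M) (K ℕ.* p)
  stable-step {M} s q K P∣M (V≡ , q≡) =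
    (begin
      lucas s q (K ℕ.* p ℕ.* p)                     ≡⟨ Quadratic.lucas-* s q (K ℕ.* p) p ⟩
      lucas (lucas s q (K ℕ.* p)) (q ^ (K ℕ.* p)) p ≈⟨ lucas-lift P∣M V≡ q≡ ⟩
      lucas (lucas s q K) (q ^ K) p                 ≡⟨ Quadratic.lucas-* s q K p ⟨
      lucas s q (K ℕ.* p)                           ∎) ,
    (begin
      q ^ (K ℕ.* p ℕ.* p)                           ≡⟨ ℤP.^-*-assoc q (K ℕ.* p) p ⟨
      (q ^ (K ℕ.* p)) ^ p                           ≈⟨ power-lift P∣M q≡ ⟩
      (q ^ K) ^ p                                   ≡⟨ ℤP.^-*-assoc q K p ⟩
      q ^ (K ℕ.* p)                                 ∎)
    where open ≡-mod-Reasoning (P * M)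

  stable : ∀ s q e K → p ℕ.^ e ℕ∣.∣ K → Stable s q (P ^ suc e) K
  -- e = 0: V_{Kp} = V_p(V_K, q^K) ≡ V_K and q^{Kp} = (q^K)^p ≡ q^K modulo p.
  stable s q zero K _ =
    mod-∣ P¹∣P (mod-trans (mod-≡ (Quadratic.lucas-* s q K p)) (lucas-prime (lucas s q K) (q ^ K))) ,
    mod-∣ P¹∣P (mod-trans (mod-≡ (sym (ℤP.^-*-assoc q K p))) (fermat (q ^ K)))
    where
    P¹∣P : P ^ 1 ℤ∣.∣ P
    P¹∣P = ℤ∣.∣-reflexive (ℤP.*-identityʳ P)
  -- e + 1: K = (c·p^e)·p with c·p^e stable modulo p^{e+1}.
  stable s q (suc e) _ (ℕ∣.divides c refl) =
    subst (Stable s q (P ^ suc (suc e))) (reassoc c)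
          (stable-step s q (c ℕ.* p ℕ.^ e) (∣m⇒∣m*n (P ^ e) ℤ∣.∣-refl) (stable s q e (c ℕ.* p ℕ.^ e) (ℕ∣.n∣m*n c)))
    where
    reassoc : ∀ c → c ℕ.* p ℕ.^ e ℕ.* p ≡ c ℕ.* p ℕ.^ suc e
    reassoc c = trans (ℕP.*-assoc c (p ℕ.^ e) p) (cong (c ℕ.*_) (ℕP.*-comm (p ℕ.^ e) p))

pos-^ : ∀ a k → + (a ℕ.^ k) ≡ (+ a) ^ k
pos-^ a zero    = refl
pos-^ a (suc k) = trans (ℤP.pos-* a (a ℕ.^ k)) (cong (+ a *_) (pos-^ a k))

d≡lucas′ : ∀ m n N → N ≢ 0 → d m n N ≡ lucas n (- m) N
d≡lucas′ m n zero    N≢0 = contradiction refl N≢0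
d≡lucas′ m n (suc N) _   = d≡lucas m n N

d-p-adic : ∀ m n {p} → Prime p → ∀ e N → N ≢ 0 → p ℕ.^ suc e ℕ∣.∣ N →
           d m n N ≡ d m n (div N p) [mod + (p ℕ.^ suc e) ]
d-p-adic m n {suc (suc k)} isPrime e N N≢0 p^e+1∣N =
  subst (λ M → d m n N ≡ d m n K [mod M ]) (sym (pos-^ p (suc e))) (begin
    d m n N                ≡⟨ d≡lucas′ m n N N≢0 ⟩
    lucas n (- m) N        ≡⟨ cong (lucas n (- m)) N≡K*p ⟩
    lucas n (- m) (K ℕ.* p) ≈⟨ proj₁ (stable n (- m) e K p^e∣K) ⟩
    lucas n (- m) K        ≡⟨ d≡lucas′ m n K K≢0 ⟨
    d m n K                ∎)
  where
  open PrimeModulus isPrime using (p; P; stable)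
  open ≡-mod-Reasoning (P ^ suc e)
  K : ℕ
  K = N ℕ./ p
  N≡K*p : N ≡ K ℕ.* p
  N≡K*p = sym (m/n*n≡m (ℕ∣.∣-trans (ℕ∣.m∣m*n (p ℕ.^ e)) p^e+1∣N))
  p^e∣K : p ℕ.^ e ℕ∣.∣ K
  p^e∣K = ℕ∣.m*n∣o⇒m∣o/n (p ℕ.^ e) p (subst (ℕ∣._∣ N) (ℕP.*-comm p (p ℕ.^ e)) p^e+1∣N)
  K≢0 : K ≢ 0
  K≢0 K≡0 = N≢0 (trans N≡K*p (cong (ℕ._* p) K≡0))

prime∣prime : ∀ {x y} → Prime x → Prime y → y ℕ∣.∣ x → y ≡ x
prime∣prime x-prime y-prime y∣x with prime⇒irreducible x-prime y∣x
... | inj₁ refl = contradiction y-prime ¬prime[1]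
... | inj₂ y≡x  = y≡x

div-cancel : ∀ {x N} → Prime x → x ℕ∣.∣ N → div N x ℕ.* x ≡ N
div-cancel {suc x} _ x∣N = m/n*n≡m x∣N

div-* : ∀ N a b → div N (a ℕ.* b) ≡ div (div N a) b
div-* N zero    b       = sym (div-zero b)
  where
  div-zero : ∀ b → div 0 b ≡ 0
  div-zero zero    = refl
  div-zero (suc b) = 0/n≡0 (suc b)
div-* N (suc a) zero    = cong (div N) (ℕP.*-zeroʳ (suc a))
div-* N (suc a) (suc b) = sym (m/n/o≡m/[n*o] N (suc a) (suc b))

div-comm : ∀ N a b → div (div N a) b ≡ div (div N b) a
div-comm N a b = trans (sym (div-* N a b)) (trans (cong (div N) (ℕP.*-comm a b)) (div-* N b a))

∣-div : ∀ {x y N} → Prime x → Prime y → y ≢ x → y ℕ∣.∣ N → x ℕ∣.∣ N → y ℕ∣.∣ div N x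
∣-div {x} {y} {N} x-prime y-prime y≢x y∣N x∣N
  with euclidsLemma (div N x) x y-prime (subst (y ℕ∣.∣_) (sym (div-cancel x-prime x∣N)) y∣N)
... | inj₁ y∣N/x = y∣N/x
... | inj₂ y∣x   = contradiction (prime∣prime x-prime y-prime y∣x) y≢x

prime-power-cancel : ∀ {p x} → Prime p → ¬ p ℕ∣.∣ x → ∀ e M → p ℕ.^ e ℕ∣.∣ M ℕ.* x → p ℕ.^ e ℕ∣.∣ M
prime-power-cancel p-prime p∤x zero    M _ = ℕ∣.1∣ M
prime-power-cancel {p} {x} p-prime p∤x (suc e) M p^e+1∣Mx
  with euclidsLemma M x p-prime (ℕ∣.∣-trans (ℕ∣.m∣m*n (p ℕ.^ e)) p^e+1∣Mx)
... | inj₂ p∣x = contradiction p∣x p∤x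
... | inj₁ (ℕ∣.divides M′ refl) =
  subst (p ℕ.^ suc e ℕ∣.∣_) (ℕP.*-comm p M′) (ℕ∣.*-monoʳ-∣ p (prime-power-cancel p-prime p∤x e M′ p^e∣M′x))
  where
  instance _ = prime⇒nonZero p-prime
  p^e∣M′x : p ℕ.^ e ℕ∣.∣ M′ ℕ.* x
  p^e∣M′x = ℕ∣.*-cancelˡ-∣ p (subst (p ℕ.^ suc e ℕ∣.∣_) (trans (cong (ℕ._* x) (ℕP.*-comm M′ p)) (ℕP.*-assoc p M′ x)) p^e+1∣Mx)

sumℤ-++ : ∀ xs ys → sumℤ (xs ++ ys) ≡ sumℤ xs + sumℤ ys
sumℤ-++ []       ys = sym (ℤP.+-identityˡ (sumℤ ys))
sumℤ-++ (x ∷ xs) ys = trans (cong (λ z → x + z) (sumℤ-++ xs ys)) (sym (ℤP.+-assoc x (sumℤ xs) (sumℤ ys)))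

sumℤ-neg : ∀ {A : Set} (f g : A → ℤ) → (∀ a → f a ≡ - g a) → ∀ as → sumℤ (map f as) ≡ - sumℤ (map g as)
sumℤ-neg f g f≡-g []       = refl
sumℤ-neg f g f≡-g (a ∷ as) = trans (cong₂ _+_ (f≡-g a) (sumℤ-neg f g f≡-g as)) (sym (ℤP.neg-distrib-+ (g a) _))

module Φ₁-Divisibility (φ : ℕ → ℤ) where

  term : ℕ → List ℕ → ℤ
  term N T = sign (length T) * φ (div N (product T))

  S : List ℕ → ℕ → ℤ
  S L N = sumℤ (map (term N) (subsets L))

  S-[] : ∀ N → S [] N ≡ φ N
  S-[] N = trans (ℤP.+-identityʳ _) (trans (ℤP.*-identityˡ _) (cong φ (n/1≡n N)))

  -- Splitting the subsets of x ∷ L by whether they contain x.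
  S-∷ : ∀ x L N → S (x ∷ L) N ≡ S L N - S L (div N x)
  S-∷ x L N = begin
    sumℤ (map (term N) (subsets L ++ map (x ∷_) (subsets L)))
      ≡⟨ cong sumℤ (map-++ (term N) (subsets L) (map (x ∷_) (subsets L))) ⟩
    sumℤ (map (term N) (subsets L) ++ map (term N) (map (x ∷_) (subsets L)))
      ≡⟨ sumℤ-++ (map (term N) (subsets L)) _ ⟩
    S L N + sumℤ (map (term N) (map (x ∷_) (subsets L)))
      ≡⟨ cong (λ z → S L N + sumℤ z) (map-∘ (subsets L)) ⟨
    S L N + sumℤ (map (λ T → term N (x ∷ T)) (subsets L))
      ≡⟨ cong (λ z → S L N + z) (sumℤ-neg _ (term (div N x)) with-x (subsets L)) ⟩
    S L N - S L (div N x) ∎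
    where
    open ≡-Reasoning
    with-x : ∀ T → term N (x ∷ T) ≡ - term (div N x) T
    with-x T = trans (cong (λ z → - sign (length T) * φ z) (div-* N x (product T)))
                     (sym (ℤP.neg-distribˡ-* (sign (length T)) _))

  module _ {p e} (p-prime : Prime p) {Q : ℤ}
           (hyp : ∀ N → N ≢ 0 → p ℕ.^ suc e ℕ∣.∣ N → φ N ≡ φ (div N p) [mod Q ]) where

    record Admissible (L : List ℕ) (N : ℕ) : Set where
      field
        nonzero   : N ≢ 0
        divisible : p ℕ.^ suc e ℕ∣.∣ N
        primes    : All (λ x → Prime x × x ℕ∣.∣ N) L
        distinct  : Unique L
    open Admissible

    drop : ∀ {x L N} → Admissible (x ∷ L) N → Admissible L N
    drop adm = record { nonzero   = nonzero adm ; divisible = divisible adm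
                      ; primes    = All.tail (primes adm) ; distinct = Unique.tail (distinct adm) }

    descend : ∀ {x L N} → Admissible (x ∷ L) N → x ≢ p → Admissible L (div N x)
    descend {x} {L} {N} adm x≢p with primes adm | distinct adm
    ... | (x-prime , x∣N) ∷ rest | x∉L ∷ L-distinct = record
      { nonzero   = λ N/x≡0 → nonzero adm (trans (sym (div-cancel x-prime x∣N)) (cong (ℕ._* x) N/x≡0))
      ; divisible = prime-power-cancel p-prime (λ p∣x → x≢p (sym (prime∣prime x-prime p-prime p∣x))) (suc e) (div N x)
                      (subst (p ℕ.^ suc e ℕ∣.∣_) (sym (div-cancel x-prime x∣N)) (divisible adm))
      ; primes    = still-dividing rest x∉L
      ; distinct  = L-distinct }
      where
      still-dividing : ∀ {L} → All (λ y → Prime y × y ℕ∣.∣ N) L → All (x ≢_) L → All (λ y → Prime y × y ℕ∣.∣ div N x) L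
      still-dividing []                        []            = []
      still-dividing ((y-prime , y∣N) ∷ rest) (x≢y ∷ x∉L) =
        (y-prime , ∣-div x-prime y-prime (x≢y ∘ sym) y∣N x∣N) ∷ still-dividing rest x∉L

    -- If p ∉ L then S L N ≡ S L (N/p): every term pairs with its image under N ↦ N/p.
    S-avoiding : ∀ L N → Admissible L N → All (_≢ p) L → S L N ≡ S L (div N p) [mod Q ]
    S-avoiding []      N adm []         = subst₂ (λ u v → u ≡ v [mod Q ]) (sym (S-[] N)) (sym (S-[] (div N p)))
                                                 (hyp N (nonzero adm) (divisible adm))
    S-avoiding (x ∷ L) N adm (x≢p ∷ ps) = begin
      S (x ∷ L) N                                ≡⟨ S-∷ x L N ⟩
      S L N - S L (div N x)                      ≈⟨ mod-- (S-avoiding L N (drop adm) ps) (S-avoiding L (div N x) (descend adm x≢p) ps) ⟩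
      S L (div N p) - S L (div (div N x) p)      ≡⟨ cong (λ z → S L (div N p) - S L z) (div-comm N x p) ⟩
      S L (div N p) - S L (div (div N p) x)      ≡⟨ S-∷ x L (div N p) ⟨
      S (x ∷ L) (div N p)                        ∎
      where open ≡-mod-Reasoning Q

    S-containing : ∀ L N → Admissible L N → p ∈ L → S L N ≡ + 0 [mod Q ]
    S-containing (x ∷ L) N adm (here refl) with distinct adm
    ... | p∉L ∷ _ = begin
      S (p ∷ L) N                 ≡⟨ S-∷ p L N ⟩
      S L N - S L (div N p)       ≈⟨ mod-- (S-avoiding L N (drop adm) (All.map (_∘ sym) p∉L)) (mod-refl (S L (div N p))) ⟩
      S L (div N p) - S L (div N p) ≡⟨ ℤP.+-inverseʳ (S L (div N p)) ⟩
      + 0                         ∎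
      where open ≡-mod-Reasoning Q
    S-containing (x ∷ L) N adm (there p∈L) = begin
      S (x ∷ L) N                 ≡⟨ S-∷ x L N ⟩
      S L N - S L (div N x)       ≈⟨ mod-- (S-containing L N (drop adm) p∈L) (S-containing L (div N x) (descend adm x≢p) p∈L) ⟩
      + 0 - + 0                   ≡⟨⟩
      + 0                         ∎
      where
      open ≡-mod-Reasoning Q
      x≢p : x ≢ p
      x≢p refl = All.lookup (AllPairs.head (distinct adm)) p∈L refl

    Φ₁≡0 : ∀ N → N ≢ 0 → p ℕ.^ suc e ℕ∣.∣ N → Φ₁ N φ ≡ + 0 [mod Q ]
    Φ₁≡0 N N≢0 p^e+1∣N = S-containing (primeDivisors N) N admissible p∈
      where
      isDivisor? = λ x → prime? x ×-dec x ℕ∣.∣? N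
      p∣N : p ℕ∣.∣ N
      p∣N = ℕ∣.∣-trans (ℕ∣.m∣m*n (p ℕ.^ e)) p^e+1∣N
      admissible : Admissible (primeDivisors N) N
      admissible = record
        { nonzero = N≢0 ; divisible = p^e+1∣N
        ; primes = all-filter isDivisor? (upTo (suc N))
        ; distinct = Unique.filter⁺ isDivisor? (Unique.upTo⁺ (suc N)) }
      p∈ : p ∈ primeDivisors N
      p∈ = ∈-filter⁺ isDivisor? (∈-upTo⁺ (ℕ.s≤s (ℕ∣.∣⇒≤ {{ℕ.≢-nonZero N≢0}} p∣N))) (p-prime , p∣N)

prime>1 : ∀ {p} → Prime p → 1 ℕ.< p
prime>1 {suc (suc _)} _ = ℕ.s≤s (ℕ.s≤s ℕ.z≤n)

prime-factor : ∀ m → Σ ℕ λ p → Prime p × p ℕ∣.∣ 2 ℕ.+ m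
prime-factor m with factorise (2 ℕ.+ m)
... | record { factors = [] ; isFactorisation = () }
... | record { factors = p ∷ ps ; isFactorisation = n≡∏ ; factorsPrime = p-prime ∷ _ } =
  p , p-prime , subst (p ℕ∣.∣_) (sym n≡∏) (ℕ∣.m∣m*n (product ps))

split-power : ∀ {p} → Prime p → ∀ D → D ≢ 0 → Σ ℕ λ a → Σ ℕ λ r → D ≡ r ℕ.* p ℕ.^ a × ¬ p ℕ∣.∣ r
split-power {p} p-prime D D≢0 = go D D≢0 (<-wellFounded D)
  where
  instance _ = prime⇒nonZero p-prime
  go : ∀ D → D ≢ 0 → Acc ℕ._<_ D → Σ ℕ λ a → Σ ℕ λ r → D ≡ r ℕ.* p ℕ.^ a × ¬ p ℕ∣.∣ r
  go D D≢0 (acc smaller) with p ℕ∣.∣? D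
  ... | no p∤D = 0 , D , sym (ℕP.*-identityʳ D) , p∤D
  ... | yes (ℕ∣.divides D′ refl) with go D′ D′≢0 (smaller (ℕP.m<m*n D′ p {{ℕ.≢-nonZero D′≢0}} (prime>1 p-prime)))
    where
    D′≢0 : D′ ≢ 0
    D′≢0 D′≡0 = D≢0 (cong (ℕ._* p) D′≡0)
  ... | a , r , D′≡ , p∤r = suc a , r , trans (cong (ℕ._* p) D′≡) (reassoc r (p ℕ.^ a)) , p∤r
    where
    reassoc : ∀ r x → r ℕ.* x ℕ.* p ≡ r ℕ.* (p ℕ.* x)
    reassoc r x = trans (ℕP.*-assoc r x p) (cong (r ℕ.*_) (ℕP.*-comm x p))

∣-combine : ∀ {p a r X} → Prime p → ¬ p ℕ∣.∣ r → r ℕ∣.∣ X → p ℕ.^ a ℕ∣.∣ X → r ℕ.* p ℕ.^ a ℕ∣.∣ X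
∣-combine {p} {a} {r} p-prime p∤r (ℕ∣.divides c refl) p^a∣cr =
  subst (ℕ∣._∣ c ℕ.* r) (ℕP.*-comm (p ℕ.^ a) r) (ℕ∣.*-monoˡ-∣ r (prime-power-cancel p-prime p∤r a c p^a∣cr))

prime-powers⇒∣ : ∀ X k → k ≢ 0 → (∀ p e → Prime p → p ℕ.^ suc e ℕ∣.∣ k → p ℕ.^ suc e ℕ∣.∣ X) → k ℕ∣.∣ X
prime-powers⇒∣ X k k≢0 powers∣X = go k k≢0 powers∣X (<-wellFounded k)
  where
  go : ∀ k → k ≢ 0 → (∀ p e → Prime p → p ℕ.^ suc e ℕ∣.∣ k → p ℕ.^ suc e ℕ∣.∣ X) → Acc ℕ._<_ k → k ℕ∣.∣ X
  go zero                k≢0 _        _ = contradiction refl k≢0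
  go (suc zero)          _   _        _ = ℕ∣.1∣ X
  go k@(suc (suc m)) k≢0 powers∣X (acc smaller)
    with prime-factor m
  ... | p , p-prime , p∣k with split-power p-prime k k≢0
  ...   | zero  , r , k≡r , p∤r = contradiction (subst (p ℕ∣.∣_) (trans k≡r (ℕP.*-identityʳ r)) p∣k) p∤r
  ...   | suc a , r , k≡r*p^a+1 , p∤r =
    subst (ℕ∣._∣ X) (sym k≡r*p^a+1)
          (∣-combine {a = suc a} p-prime p∤r (go r r≢0 (λ q f q-prime q^f+1∣r → powers∣X q f q-prime (ℕ∣.∣-trans q^f+1∣r r∣k)) (smaller r<k))
                     (powers∣X p a p-prime (subst (p ℕ.^ suc a ℕ∣.∣_) (sym k≡r*p^a+1) (ℕ∣.n∣m*n r))))
    where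
    instance _ = prime⇒nonZero p-prime
    r≢0 : r ≢ 0
    r≢0 r≡0 = k≢0 (trans k≡r*p^a+1 (cong (ℕ._* p ℕ.^ suc a) r≡0))
    r∣k : r ℕ∣.∣ k
    r∣k = subst (r ℕ∣.∣_) (sym k≡r*p^a+1) (ℕ∣.m∣m*n (p ℕ.^ suc a))
    r<k : r ℕ.< k
    r<k = subst (r ℕ.<_) (sym k≡r*p^a+1)
                (ℕP.m<m*n r (p ℕ.^ suc a) {{ℕ.≢-nonZero r≢0}}
                          (ℕP.<-≤-trans (prime>1 p-prime) (ℕP.m≤m*n p (p ℕ.^ a) {{ℕP.m^n≢0 p a}})))

sumTo-vanish : ∀ k (f : ℕ → ℤ) → (∀ i → i ℕ.≤ k → f i ≡ + 0) → sumTo k f ≡ + 0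
sumTo-vanish zero    f f≡0 = f≡0 0 ℕ.z≤n
sumTo-vanish (suc k) f f≡0 =
  cong₂ _+_ (sumTo-vanish k f (λ i i≤k → f≡0 i (ℕP.m≤n⇒m≤1+n i≤k))) (f≡0 (suc k) ℕP.≤-refl)

generating-function : ∀ m n j → (G m n ⋆ denom m n) j ≡ numer m n j
generating-function m n 0 = refl
generating-function m n 1 = first n
  where
  first : ∀ n → + 0 * + 1 + n * + 1 ≡ n
  first = solve-∀
generating-function m n 2 = second m n
  where
  second : ∀ m n → + 0 * + 1 + n * (- n) + (n * n + + 2 * m) * + 1 ≡ + 2 * m
  second = solve-∀
-- Beyond z², only the three terms meeting 1, −n z, −m z² survive, and they
-- cancel by the recurrence.
generating-function m n (suc (suc (suc j))) = begin
  sumTo j f + f (1 ℕ.+ j) + f (2 ℕ.+ j) + f (3 ℕ.+ j)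
    ≡⟨ cong (λ z → z + f (1 ℕ.+ j) + f (2 ℕ.+ j) + f (3 ℕ.+ j)) (sumTo-vanish j f early) ⟩
  outer (3 ℕ.+ j ∸ (1 ℕ.+ j)) (3 ℕ.+ j ∸ (2 ℕ.+ j)) (j ∸ j)
    ≡⟨ cong₂ (λ a b → outer a b (j ∸ j)) (ℕP.m+n∸n≡m 2 j) (ℕP.m+n∸n≡m 1 j) ⟩
  outer 2 1 (j ∸ j)
    ≡⟨ cong (outer 2 1) (ℕP.n∸n≡0 j) ⟩
  + 0 + dₖ (1 ℕ.+ j) * (- m) + dₖ (2 ℕ.+ j) * (- n) + (n * dₖ (2 ℕ.+ j) + m * dₖ (1 ℕ.+ j)) * + 1
    ≡⟨ cancel (dₖ (1 ℕ.+ j)) (dₖ (2 ℕ.+ j)) m n ⟩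
  + 0 ∎
  where
  open ≡-Reasoning
  dₖ : ℕ → ℤ
  dₖ = d m n
  f : ℕ → ℤ
  f i = dₖ i * denom m n (3 ℕ.+ j ∸ i)
  -- the last three terms, with the indices into denom given explicitly
  outer : ℕ → ℕ → ℕ → ℤ
  outer a b c = + 0 + dₖ (1 ℕ.+ j) * denom m n a + dₖ (2 ℕ.+ j) * denom m n b + dₖ (3 ℕ.+ j) * denom m n c
  early : ∀ i → i ℕ.≤ j → f i ≡ + 0
  early i i≤j = trans (cong (λ k → dₖ i * denom m n k) (ℕP.+-∸-assoc 3 i≤j)) (ℤP.*-zeroʳ (dₖ i))
  cancel : ∀ a b m n → + 0 + a * (- m) + b * (- n) + (n * b + m * a) * + 1 ≡ + 0
  cancel = solve-∀

Φ₁-d-prime-power : ∀ m n {p} e → Prime p → ∀ N → N ≢ 0 → p ℕ.^ suc e ℕ∣.∣ N →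
                   + (p ℕ.^ suc e) ℤ∣.∣ Φ₁ N (d m n)
Φ₁-d-prime-power m n e p-prime N N≢0 p^e+1∣N =
  subst (+ _ ℤ∣.∣_) (ℤP.+-identityʳ (Φ₁ N (d m n)))
        (difference (Φ₁-Divisibility.Φ₁≡0 (d m n) {e = e} p-prime (d-p-adic m n p-prime e) N N≢0 p^e+1∣N))

theorem5 : (n m : ℤ) → + 2 ℤ.≤ n → + 1 - n ℤ.≤ m → m ℤ.≤ n →
    ((k : ℕ) → 1 ℕ.≤ k → (+ k) ∣ Φ₁ k (d m n))
    × ((j : ℕ) → (G m n ⋆ denom m n) j ≡ numer m n j)
theorem5 n m _ _ _ = gauss-congruence , generating-function m n
  where
  gauss-congruence : (k : ℕ) → 1 ℕ.≤ k → (+ k) ∣ Φ₁ k (d m n)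
  gauss-congruence k@(suc _) _ = prime-powers⇒∣ _ k (λ ())
    (λ p e p-prime p^e+1∣k → ℤ∣.∣⇒∣ᵤ (Φ₁-d-prime-power m n e p-prime k (λ ()) p^e+1∣k))
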